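{- Let $(s(0,k))_{k\in\mathbb{Z}}$ be an arbitrary sequence of real numbers such that $s(0,k)\neq 0$ for only finitely many $k$. Given $\alpha,\beta\in\mathbb{R}$, define $s(n,k)$ recursively for $n\in\mathbb{N}$, $n\ge 1$, and $k\in\mathbb{Z}$ by \[ s(n,k)=\alpha\, s(n-1,k-1)+\beta\, s(n-1,k)+\alpha\, s(n-1,k+1). \] Fix $k_0\in\mathbb{Z}$ and define, for $n\ge 0$, \[ d_n=\sum_{j=-\infty}^{\infty}\Bigl[s(n,k_0-5j)-s(n,k_0-5j-1)\Bigr]. \] Then for all $n\ge 2$, \[ d_n=(2\beta-\alpha)\,d_{n-1}+(\alpha\beta+\alpha^2-\beta^2)\,d_{n-2}. \]
   Context: The sums defining $d_n$ are finite, since each row $(s(n,k))_k$ has only finitely many nonzero entries. -}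

module Defs where

open import Level using (Level)
open import Algebra.Bundles using (CommutativeRing)
open import Data.Nat using (ℕ; zero; suc) renaming (_≤_ to _≤ℕ_; _<_ to _<ℕ_)
open import Data.Integer as ℤ using (ℤ; +_; -[1+_]; ∣_∣)
open import Data.Product using (∃; Σ; _,_)

module _ {c ℓ : Level} (R : CommutativeRing c ℓ) where
  open CommutativeRing R

  sArr : (α β : Carrier) (s0 : ℤ → Carrier) → ℕ → ℤ → Carrier
  sArr α β s0 zero    k = s0 k
  sArr α β s0 (suc n) k =
    α * sArr α β s0 n (k ℤ.- ℤ.1ℤ) + β * sArr α β s0 n k + α * sArr α β s0 n (k ℤ.+ ℤ.1ℤ)

  FinSupp : (ℤ → Carrier) → Set ℓ
  FinSupp f = ∃ λ (N : ℕ) → ∀ (k : ℤ) → N <ℕ ∣ k ∣ → f k ≈ 0#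

  symSum : (ℤ → Carrier) → ℕ → Carrier
  symSum f zero    = f (+ 0)
  symSum f (suc M) = f (+ suc M) + f -[1+ M ] + symSum f M

  -- S is the value of the (two-sided) series Σ_{j ∈ ℤ} f j :
  -- the symmetric partial sums are eventually constant equal to S
  -- (for finitely supported f this is exactly the finite sum).
  HasSum : (ℤ → Carrier) → Carrier → Set ℓ
  HasSum f S = ∃ λ (M : ℕ) → ∀ (M' : ℕ) → M ≤ℕ M' → symSum f M' ≈ S

-- Let T = α x⁻¹ + β + α x be the transfer operator of the recurrence, acting on
-- Laurent polynomials in the column index.  With p = 2β − α and q = αβ + α² − β²
-- one has T² − p T − q = α² (x⁻² + x⁻¹ + 1 + x + x²), so the defect
-- s(n+2,k) − p s(n+1,k) − q s(n,k) is α² times a window sum of five consecutive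
-- entries of row n.  Along the residue class k₀ − 5ℤ the differences of these
-- window sums telescope, leaving two boundary entries which vanish once the
-- partial sum is long enough, by finite support of the rows.
module Submission where

open import Defs
open import Level using (Level)
open import Algebra.Bundles using (CommutativeRing)
open import Data.Nat using (ℕ; suc)
open import Data.Integer as ℤ using (ℤ; +_)

open import Data.Nat as ℕ using (zero; _⊔_)
open import Data.Integer using (-[1+_]; ∣_∣; 1ℤ)
open import Data.Maybe using (Maybe; just; nothing)
open import Relation.Nullary using (yes; no)
open import Data.Product using (_,_)
import Data.Nat.Properties as ℕP
import Data.Integer.Properties as ℤP
open import Data.Integer.Tactic.RingSolver using (solve-∀)
open import Relation.Binary.PropositionalEquality as P using (_≡_)
open import Algebra.Solver.Ring.AlmostCommutativeRing
  using (fromCommutativeRing; _-Raw-AlmostCommutative⟶_)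
import Algebra.Solver.Ring as RingSolver

prev next : ℤ → ℤ
prev k = k ℤ.- 1ℤ
next k = k ℤ.+ 1ℤ

next-prev : ∀ k → next (prev k) ≡ k
next-prev = [k-1]+1≡k
  where
  -- solve-∀ only recognises the ring operations, so prev and next are unfolded here.
  [k-1]+1≡k : ∀ k → k ℤ.- 1ℤ ℤ.+ 1ℤ ≡ k
  [k-1]+1≡k = solve-∀

prev-next : ∀ k → prev (next k) ≡ k
prev-next = [k+1]-1≡k
  where
  [k+1]-1≡k : ∀ k → k ℤ.+ 1ℤ ℤ.- 1ℤ ≡ k
  [k+1]-1≡k = solve-∀

m+∣i∣<∣j∣⇒m<∣j+i∣ : ∀ m i j → m ℕ.+ ∣ i ∣ ℕ.< ∣ j ∣ → m ℕ.< ∣ j ℤ.+ i ∣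
m+∣i∣<∣j∣⇒m<∣j+i∣ m i j lt =
  ℕP.+-cancelʳ-< (∣ i ∣) m (∣ j ℤ.+ i ∣) (ℕP.<-≤-trans lt ∣j∣≤∣j+i∣+∣i∣)
  where
  [j+i]-i≡j : ∀ i j → j ℤ.+ i ℤ.- i ≡ j
  [j+i]-i≡j = solve-∀

  ∣j∣≤∣j+i∣+∣i∣ : ∣ j ∣ ℕ.≤ ∣ j ℤ.+ i ∣ ℕ.+ ∣ i ∣
  ∣j∣≤∣j+i∣+∣i∣ = P.subst (λ x → ∣ x ∣ ℕ.≤ ∣ j ℤ.+ i ∣ ℕ.+ ∣ i ∣) ([j+i]-i≡j i j)
    (ℤP.∣i-j∣≤∣i∣+∣j∣ (j ℤ.+ i) i)

-- The ring solver needs coefficients with a (semi-)decidable equality; the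
-- canonical homomorphism ℤ → R provides them for an arbitrary commutative ring.
module IntegerCoefficients {c ℓ : Level} (R : CommutativeRing c ℓ) where
  open CommutativeRing R
  open import Relation.Binary.Reasoning.Setoid setoid
  open import Algebra.Properties.Ring ring using (-‿+-comm; -‿involutive; -‿distribˡ-*; -‿distribʳ-*; -0#≈0#)
  open import Algebra.Properties.Semiring.Mult semiring using (_×_; ×-homo-+; ×1-homo-*)

  ι : ℤ → Carrier
  ι (+ n) = n × 1#
  ι -[1+ n ] = - (suc n × 1#)

  [1+x]-[1+y]≈x-y : ∀ x y → (1# + x) - (1# + y) ≈ x - y
  [1+x]-[1+y]≈x-y x y = begin
    (1# + x) + - (1# + y)   ≈⟨ +-congˡ (sym (-‿+-comm 1# y)) ⟩
    (1# + x) + (- 1# + - y) ≈⟨ +-assoc _ _ _ ⟩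
    1# + (x + (- 1# + - y)) ≈⟨ +-congˡ (sym (+-assoc _ _ _)) ⟩
    1# + ((x + - 1#) + - y) ≈⟨ +-congˡ (+-congʳ (+-comm _ _)) ⟩
    1# + ((- 1# + x) + - y) ≈⟨ +-congˡ (+-assoc _ _ _) ⟩
    1# + (- 1# + (x + - y)) ≈⟨ sym (+-assoc _ _ _) ⟩
    (1# + - 1#) + (x + - y) ≈⟨ +-congʳ (-‿inverseʳ _) ⟩
    0# + (x + - y)          ≈⟨ +-identityˡ _ ⟩
    x - y                   ∎

  ι-⊖ : ∀ m n → ι (m ℤ.⊖ n) ≈ m × 1# - n × 1#
  ι-⊖ zero zero = sym (-‿inverseʳ 0#)
  ι-⊖ (suc m) zero = sym (trans (+-congˡ -0#≈0#) (+-identityʳ _))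
  ι-⊖ zero (suc n) = sym (+-identityˡ _)
  ι-⊖ (suc m) (suc n) = begin
    ι (suc m ℤ.⊖ suc n)         ≡⟨ P.cong ι (ℤP.[1+m]⊖[1+n]≡m⊖n m n) ⟩
    ι (m ℤ.⊖ n)                 ≈⟨ ι-⊖ m n ⟩
    m × 1# - n × 1#             ≈⟨ sym ([1+x]-[1+y]≈x-y _ _) ⟩
    suc m × 1# - suc n × 1#     ∎

  ι-neg : ∀ i → ι (ℤ.- i) ≈ - ι i
  ι-neg (+ zero) = sym -0#≈0#
  ι-neg (+ suc n) = refl
  ι-neg -[1+ n ] = sym (-‿involutive _)

  ι-+ : ∀ i j → ι (i ℤ.+ j) ≈ ι i + ι j
  ι-+ (+ m) (+ n) = ×-homo-+ 1# m n
  ι-+ (+ m) -[1+ n ] = ι-⊖ m (suc n)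
  ι-+ -[1+ m ] (+ n) = trans (ι-⊖ n (suc m)) (+-comm _ _)
  ι-+ -[1+ m ] -[1+ n ] = begin
    - (suc (suc (m ℕ.+ n)) × 1#)      ≡⟨ P.cong (λ k → - (k × 1#)) (P.sym (ℕP.+-suc (suc m) n)) ⟩
    - ((suc m ℕ.+ suc n) × 1#)        ≈⟨ -‿cong (×-homo-+ 1# (suc m) (suc n)) ⟩
    - (suc m × 1# + suc n × 1#)       ≈⟨ sym (-‿+-comm _ _) ⟩
    - (suc m × 1#) + - (suc n × 1#)   ∎

  ι-+* : ∀ m j → ι (+ m ℤ.* j) ≈ m × 1# * ι j
  ι-+* m (+ n) = P.subst (λ k → ι k ≈ m × 1# * n × 1#) (ℤP.pos-* m n) (×1-homo-* m n)
  ι-+* m -[1+ n ] = begin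
    ι (+ m ℤ.* -[1+ n ])           ≡⟨ P.cong ι (P.sym (ℤP.neg-distribʳ-* (+ m) (+ suc n))) ⟩
    ι (ℤ.- (+ m ℤ.* + suc n))      ≈⟨ ι-neg (+ m ℤ.* + suc n) ⟩
    - ι (+ m ℤ.* + suc n)          ≈⟨ -‿cong (ι-+* m (+ suc n)) ⟩
    - (m × 1# * suc n × 1#)        ≈⟨ -‿distribʳ-* _ _ ⟩
    m × 1# * - (suc n × 1#)        ∎

  ι-* : ∀ i j → ι (i ℤ.* j) ≈ ι i * ι j
  ι-* (+ m) j = ι-+* m j
  ι-* -[1+ m ] j = begin
    ι (-[1+ m ] ℤ.* j)              ≡⟨ P.cong ι (P.sym (ℤP.neg-distribˡ-* (+ suc m) j)) ⟩
    ι (ℤ.- (+ suc m ℤ.* j))         ≈⟨ ι-neg (+ suc m ℤ.* j) ⟩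
    - ι (+ suc m ℤ.* j)             ≈⟨ -‿cong (ι-+* (suc m) j) ⟩
    - (suc m × 1# * ι j)            ≈⟨ -‿distribˡ-* _ _ ⟩
    - (suc m × 1#) * ι j            ∎

  ι-homomorphism : ℤ.+-*-rawRing -Raw-AlmostCommutative⟶ fromCommutativeRing R
  ι-homomorphism = record
    { ⟦_⟧ = ι ; +-homo = ι-+ ; *-homo = ι-* ; -‿homo = ι-neg
    ; 0-homo = refl ; 1-homo = +-identityʳ 1# }

  ι-≈? : ∀ i j → Maybe (ι i ≈ ι j)
  ι-≈? i j with i ℤ.≟ j
  ... | yes P.refl = just refl
  ... | no _ = nothing

  open RingSolver ℤ.+-*-rawRing (fromCommutativeRing R) ι-homomorphism ι-≈? public

module _ {c ℓ : Level} (R : CommutativeRing c ℓ) where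
  open CommutativeRing R
  open import Relation.Binary.Reasoning.Setoid setoid
  open import Algebra.Properties.Ring ring using (x[y-z]≈xy-xz)
  open IntegerCoefficients R using (solve; _:+_; _:*_; _:-_; _:=_)

  symSum-telescope : ∀ (f h : ℤ → Carrier) → (∀ j → f j ≈ h j - h (next j)) →
    ∀ M → symSum R f M ≈ h (ℤ.- (+ M)) - h (+ suc M)
  symSum-telescope f h f≈Δh zero = f≈Δh (+ 0)
  symSum-telescope f h f≈Δh (suc M) = begin
    f (+ suc M) + f -[1+ M ] + symSum R f M
      ≈⟨ +-cong (+-cong (f≈Δh _) (f≈Δh _)) (symSum-telescope f h f≈Δh M) ⟩
    (h (+ suc M) - h (next (+ suc M))) + (h -[1+ M ] - h (next -[1+ M ])) + (h (ℤ.- (+ M)) - h (+ suc M))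
      ≡⟨ P.cong₂ (λ u v → (h (+ suc M) - h u) + (h -[1+ M ] - h v) + (h (ℤ.- (+ M)) - h (+ suc M)))
           (P.cong (λ m → + suc m) (ℕP.+-comm M 1)) (next-[1+M]≡-M M) ⟩
    (h (+ suc M) - h (+ suc (suc M))) + (h -[1+ M ] - h (ℤ.- (+ M))) + (h (ℤ.- (+ M)) - h (+ suc M))
      ≈⟨ cancel-middle _ _ _ _ ⟩
    h -[1+ M ] - h (+ suc (suc M)) ∎
    where
    cancel-middle : ∀ a b c d → (a - b) + (c - d) + (d - a) ≈ c - b
    cancel-middle = solve 4 (λ a b c d → (a :- b) :+ (c :- d) :+ (d :- a) := c :- b) refl

    next-[1+M]≡-M : ∀ M → next -[1+ M ] ≡ ℤ.- (+ M)
    next-[1+M]≡-M zero = P.refl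
    next-[1+M]≡-M (suc M) = P.refl

  module Defect (p q : Carrier) where

    defect : (ℕ → Carrier) → ℕ → Carrier
    defect u n = u (suc (suc n)) - p * u (suc n) - q * u n

    defect≈0⇒recurrence : ∀ u n → defect u n ≈ 0# → u (suc (suc n)) ≈ p * u (suc n) + q * u n
    defect≈0⇒recurrence u n defect≈0 = begin
      u (suc (suc n))                                 ≈⟨ sym (x-y-z+[y+z]≈x _ _ _) ⟩
      defect u n + (p * u (suc n) + q * u n)          ≈⟨ +-congʳ defect≈0 ⟩
      0# + (p * u (suc n) + q * u n)                  ≈⟨ +-identityˡ _ ⟩
      p * u (suc n) + q * u n                         ∎
      where
      x-y-z+[y+z]≈x : ∀ x y z → x - y - z + (y + z) ≈ x
      x-y-z+[y+z]≈x = solve 3 (λ x y z → x :- y :- z :+ (y :+ z) := x) refl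

    defect-cong : ∀ u v n → u (suc (suc n)) ≈ v (suc (suc n)) → u (suc n) ≈ v (suc n) → u n ≈ v n →
      defect u n ≈ defect v n
    defect-cong u v n e₂ e₁ e₀ = +-cong (+-cong e₂ (-‿cong (*-congˡ e₁))) (-‿cong (*-congˡ e₀))

    defect-sub : ∀ u v n → defect (λ m → u m - v m) n ≈ defect u n - defect v n
    defect-sub u v n = linear _ _ _ _ _ _
      where
      linear : ∀ a₂ b₂ a₁ b₁ a₀ b₀ →
        (a₂ - b₂) - p * (a₁ - b₁) - q * (a₀ - b₀) ≈ (a₂ - p * a₁ - q * a₀) - (b₂ - p * b₁ - q * b₀)
      linear = solve 8 (λ p q a₂ b₂ a₁ b₁ a₀ b₀ →
        (a₂ :- b₂) :- p :* (a₁ :- b₁) :- q :* (a₀ :- b₀) := (a₂ :- p :* a₁ :- q :* a₀) :- (b₂ :- p :* b₁ :- q :* b₀))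
        refl p q

    defect-symSum : ∀ (f : ℕ → ℤ → Carrier) n M →
      defect (λ m → symSum R (f m) M) n ≈ symSum R (λ j → defect (λ m → f m j) n) M
    defect-symSum f n zero = refl
    defect-symSum f n (suc M) = trans (linear _ _ _ _ _ _ _ _ _) (+-congˡ (defect-symSum f n M))
      where
      linear : ∀ a₂ b₂ c₂ a₁ b₁ c₁ a₀ b₀ c₀ →
        (a₂ + b₂ + c₂) - p * (a₁ + b₁ + c₁) - q * (a₀ + b₀ + c₀)
          ≈ (a₂ - p * a₁ - q * a₀) + (b₂ - p * b₁ - q * b₀) + (c₂ - p * c₁ - q * c₀)
      linear = solve 11 (λ p q a₂ b₂ c₂ a₁ b₁ c₁ a₀ b₀ c₀ →
        (a₂ :+ b₂ :+ c₂) :- p :* (a₁ :+ b₁ :+ c₁) :- q :* (a₀ :+ b₀ :+ c₀)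
          := (a₂ :- p :* a₁ :- q :* a₀) :+ (b₂ :- p :* b₁ :- q :* b₀) :+ (c₂ :- p :* c₁ :- q :* c₀))
        refl p q

  module Array (α β : Carrier) (s0 : ℤ → Carrier) where

    s : ℕ → ℤ → Carrier
    s = sArr R α β s0

    open Defect (β + β - α) (α * β + α * α - β * β) public

    window : ℕ → ℤ → Carrier
    window n k = s n (prev (prev k)) + s n (prev k) + s n k + s n (next k) + s n (next (next k))

    defect-sArr : ∀ n k → defect (λ m → s m k) n ≈ α * α * window n k
    defect-sArr n k = begin
      defect (λ m → s m k) n
        ≡⟨ P.cong₂ (λ u v → α * (α * s n (prev (prev k)) + β * s n (prev k) + α * s n u) + β * s (suc n) k
                             + α * (α * s n v + β * s n (next k) + α * s n (next (next k)))
                             - (β + β - α) * s (suc n) k - (α * β + α * α - β * β) * s n k)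
             (next-prev k) (prev-next k) ⟩
      _ ≈⟨ characteristic _ _ _ _ _ _ _ ⟩
      α * α * window n k ∎
      where
      -- T² − p T − q = α² (x⁻² + x⁻¹ + 1 + x + x²), read off coefficientwise.
      characteristic : ∀ α β a b c d e →
        α * (α * a + β * b + α * c) + β * (α * b + β * c + α * d) + α * (α * c + β * d + α * e)
          - (β + β - α) * (α * b + β * c + α * d) - (α * β + α * α - β * β) * c
        ≈ α * α * (a + b + c + d + e)
      characteristic = solve 7 (λ α β a b c d e →
        α :* (α :* a :+ β :* b :+ α :* c) :+ β :* (α :* b :+ β :* c :+ α :* d) :+ α :* (α :* c :+ β :* d :+ α :* e)
          :- (β :+ β :- α) :* (α :* b :+ β :* c :+ α :* d) :- (α :* β :+ α :* α :- β :* β) :* c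
        := α :* α :* (a :+ b :+ c :+ d :+ e)) refl

    window-difference : ∀ n k → window n k - window n (prev k) ≈ s n (next (next k)) - s n (prev (prev (prev k)))
    window-difference n k = begin
      window n k - window n (prev k)
        ≡⟨ P.cong₂ (λ u v → window n k - (s n (prev (prev (prev k))) + s n (prev (prev k)) + s n (prev k) + s n u + s n v))
             (next-prev k) (P.cong next (next-prev k)) ⟩
      _ ≈⟨ telescope _ _ _ _ _ _ ⟩
      s n (next (next k)) - s n (prev (prev (prev k))) ∎
      where
      telescope : ∀ a b c d e f → (a + b + c + d + e) - (f + a + b + c + d) ≈ e - f
      telescope = solve 6 (λ a b c d e f → (a :+ b :+ c :+ d :+ e) :- (f :+ a :+ b :+ c :+ d) := e :- f) refl

    sArr-support : ∀ N → (∀ k → N ℕ.< ∣ k ∣ → s0 k ≈ 0#) → ∀ n k → N ℕ.+ n ℕ.< ∣ k ∣ → s n k ≈ 0#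
    sArr-support N s0≈0 zero k lt = s0≈0 k (P.subst (ℕ._< ∣ k ∣) (ℕP.+-identityʳ N) lt)
    sArr-support N s0≈0 (suc n) k lt = begin
      α * s n (prev k) + β * s n k + α * s n (next k)
        ≈⟨ +-cong (+-cong (vanish α (m+∣i∣<∣j∣⇒m<∣j+i∣ _ (ℤ.- 1ℤ) k lt′))
                          (vanish β (ℕP.<-trans (ℕP.m<m+n _ ℕ.z<s) lt′)))
                  (vanish α (m+∣i∣<∣j∣⇒m<∣j+i∣ _ 1ℤ k lt′)) ⟩
      0# + 0# + 0# ≈⟨ trans (+-identityʳ _) (+-identityʳ _) ⟩
      0# ∎
      where
      lt′ : N ℕ.+ n ℕ.+ 1 ℕ.< ∣ k ∣
      lt′ = P.subst (ℕ._< ∣ k ∣) (P.trans (ℕP.+-suc N n) (ℕP.+-comm 1 (N ℕ.+ n))) lt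

      vanish : ∀ a {k} → N ℕ.+ n ℕ.< ∣ k ∣ → a * s n k ≈ 0#
      vanish a {k} lt = trans (*-congˡ (sArr-support N s0≈0 n k lt)) (zeroʳ a)

    module Column (k0 : ℤ) where

      column : ℤ → ℤ
      column j = k0 ℤ.- + 5 ℤ.* j

      term : ℕ → ℤ → Carrier
      term n j = s n (column j) - s n (prev (column j))

      boundary : ℕ → ℤ → Carrier
      boundary n j = α * α * s n (next (next (column j)))

      defect-term : ∀ n j → defect (λ m → term m j) n ≈ boundary n j - boundary n (next j)
      defect-term n j = begin
        defect (λ m → term m j) n
          ≈⟨ defect-sub (λ m → s m (column j)) (λ m → s m (prev (column j))) n ⟩
        defect (λ m → s m (column j)) n - defect (λ m → s m (prev (column j))) n
          ≈⟨ +-cong (defect-sArr n (column j)) (-‿cong (defect-sArr n (prev (column j)))) ⟩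
        α * α * window n (column j) - α * α * window n (prev (column j))
          ≈⟨ sym (x[y-z]≈xy-xz _ _ _) ⟩
        α * α * (window n (column j) - window n (prev (column j)))
          ≈⟨ *-congˡ (window-difference n (column j)) ⟩
        α * α * (s n (next (next (column j))) - s n (prev (prev (prev (column j)))))
          ≡⟨ P.cong (λ k → α * α * (s n (next (next (column j))) - s n k)) (column-step j) ⟩
        α * α * (s n (next (next (column j))) - s n (next (next (column (next j)))))
          ≈⟨ x[y-z]≈xy-xz _ _ _ ⟩
        boundary n j - boundary n (next j) ∎
        where
        column-step : ∀ j → prev (prev (prev (column j))) ≡ next (next (column (next j)))
        column-step = step k0
          where
          step : ∀ k0 j → k0 ℤ.- + 5 ℤ.* j ℤ.- 1ℤ ℤ.- 1ℤ ℤ.- 1ℤ ≡ k0 ℤ.- + 5 ℤ.* (j ℤ.+ 1ℤ) ℤ.+ 1ℤ ℤ.+ 1ℤ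
          step = solve-∀

      boundary-vanishes : ∀ N → (∀ k → N ℕ.< ∣ k ∣ → s0 k ≈ 0#) →
        ∀ n j → N ℕ.+ n ℕ.+ ∣ next (next k0) ∣ ℕ.< ∣ j ∣ → boundary n j ≈ 0#
      boundary-vanishes N s0≈0 n j lt =
        trans (*-congˡ (sArr-support N s0≈0 n _ far)) (zeroʳ (α * α))
        where
        ∣j∣≤∣-5j∣ : ∣ j ∣ ℕ.≤ ∣ ℤ.- (+ 5 ℤ.* j) ∣
        ∣j∣≤∣-5j∣ = P.subst (∣ j ∣ ℕ.≤_) (P.sym (P.trans (ℤP.∣-i∣≡∣i∣ (+ 5 ℤ.* j)) (ℤP.∣i*j∣≡∣i∣*∣j∣ (+ 5) j)))
          (ℕP.m≤n*m ∣ j ∣ 5)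

        shift : ∀ k0 j → ℤ.- (+ 5 ℤ.* j) ℤ.+ (k0 ℤ.+ 1ℤ ℤ.+ 1ℤ) ≡ k0 ℤ.- + 5 ℤ.* j ℤ.+ 1ℤ ℤ.+ 1ℤ
        shift = solve-∀

        far : N ℕ.+ n ℕ.< ∣ next (next (column j)) ∣
        far = P.subst (λ k → N ℕ.+ n ℕ.< ∣ k ∣) (shift k0 j)
          (m+∣i∣<∣j∣⇒m<∣j+i∣ _ (next (next k0)) (ℤ.- (+ 5 ℤ.* j)) (ℕP.<-≤-trans lt ∣j∣≤∣-5j∣))

      defect-series : FinSupp R s0 → ∀ d → (∀ n → HasSum R (term n) (d n)) → ∀ n → defect d n ≈ 0#
      defect-series (N , s0≈0) d hasSum n with hasSum n | hasSum (suc n) | hasSum (suc (suc n))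
      ... | M₀ , sum₀ | M₁ , sum₁ | M₂ , sum₂ = begin
        defect d n
          ≈⟨ defect-cong d (λ m → symSum R (term m) M) n (sym (sum₂ M M₂≤M)) (sym (sum₁ M M₁≤M)) (sym (sum₀ M M₀≤M)) ⟩
        defect (λ m → symSum R (term m) M) n
          ≈⟨ defect-symSum term n M ⟩
        symSum R (λ j → defect (λ m → term m j) n) M
          ≈⟨ symSum-telescope _ (boundary n) (defect-term n) M ⟩
        boundary n (ℤ.- (+ M)) - boundary n (+ suc M)
          ≈⟨ +-cong (boundary-vanishes N s0≈0 n (ℤ.- (+ M)) B<∣-M∣) (-‿cong (boundary-vanishes N s0≈0 n (+ suc M) (ℕP.m<n⇒m<1+n B<M))) ⟩
        0# - 0#
          ≈⟨ -‿inverseʳ 0# ⟩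
        0# ∎
        where
        B : ℕ
        B = N ℕ.+ n ℕ.+ ∣ next (next k0) ∣

        M : ℕ
        M = suc B ⊔ (M₀ ⊔ (M₁ ⊔ M₂))

        B<M : B ℕ.< M
        B<M = ℕP.m≤m⊔n (suc B) (M₀ ⊔ (M₁ ⊔ M₂))

        B<∣-M∣ : B ℕ.< ∣ ℤ.- (+ M) ∣
        B<∣-M∣ = P.subst (B ℕ.<_) (P.sym (ℤP.∣-i∣≡∣i∣ (+ M))) B<M

        M₀≤M : M₀ ℕ.≤ M
        M₀≤M = ℕP.≤-trans (ℕP.m≤m⊔n M₀ _) (ℕP.m≤n⊔m (suc B) _)

        M₁≤M : M₁ ℕ.≤ M
        M₁≤M = ℕP.≤-trans (ℕP.m≤m⊔n M₁ M₂) (ℕP.≤-trans (ℕP.m≤n⊔m M₀ _) (ℕP.m≤n⊔m (suc B) _))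

        M₂≤M : M₂ ℕ.≤ M
        M₂≤M = ℕP.≤-trans (ℕP.m≤n⊔m M₁ M₂) (ℕP.≤-trans (ℕP.m≤n⊔m M₀ _) (ℕP.m≤n⊔m (suc B) _))

mainTheorem1 : {c ℓ : Level} (R : CommutativeRing c ℓ) →
    let open CommutativeRing R in
    (α β : Carrier) (s0 : ℤ → Carrier) → FinSupp R s0 →
    (k0 : ℤ) (d : ℕ → Carrier) →
    ((n : ℕ) → HasSum R (λ j → sArr R α β s0 n (k0 ℤ.- (+ 5) ℤ.* j) - sArr R α β s0 n (k0 ℤ.- (+ 5) ℤ.* j ℤ.- ℤ.1ℤ)) (d n)) →
    (n : ℕ) → d (suc (suc n)) ≈ (β + β - α) * d (suc n) + (α * β + α * α - β * β) * d n
mainTheorem1 R α β s0 finSupp k0 d hasSum n =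
  defect≈0⇒recurrence d n (defect-series finSupp d hasSum n)
  where
  open Array R α β s0
  open Column k0
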